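{- For every positive integer $h$, the average distance of the multiplicative circulant graph $\Gamma_{2^h}=MC(2^h)$ is $$\mu(\Gamma_{2^h})=\begin{cases}\dfrac{2^h(3h+1)-1}{9(2^h-1)} & \text{if } h \text{ is even},\\[2mm] \dfrac{2^h(3h+1)+1}{9(2^h-1)} & \text{if } h \text{ is odd}.\end{cases}$$
   Context: For integers $m>1$, $h>0$, $MC(m^h)$ is the graph with vertex set $\mathbb{Z}_{m^h}$ in which distinct vertices $x,y$ are adjacent iff $x-y\equiv \pm m^i \pmod{m^h}$ for some $i\in\{0,\ldots,h-1\}$. For a graph $\Gamma$ with $N$ vertices, the average distance is $\mu(\Gamma)=\frac{1}{N(N-1)}\sum_{v_i,v_j\in V(\Gamma)} d_\Gamma(v_i,v_j)$, the sum over all ordered pairs of vertices, where $d_\Gamma$ is shortest-path distance. -}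

module Defs where

open import Data.Nat using (ℕ; zero; suc; _+_; _*_; _∸_; _^_; _≤_; _<_; _%_)
open import Data.Nat.DivMod using ()
open import Data.Integer using (+_)
open import Data.Rational using (ℚ; _/_; 0ℚ)
open import Data.List using (List; map; upTo)
open import Data.Nat.ListAction using (sum)
open import Data.Product using (Σ; ∃; _×_; _,_)
open import Data.Sum using (_⊎_)
open import Relation.Binary.PropositionalEquality using (_≡_; _≢_)

order : ℕ → ℕ → ℕ
order m h = m ^ h

-- remainder with the convention a %′ 0 = a (never relevant: m^h ≥ 2 in use)
_%′_ : ℕ → ℕ → ℕ
a %′ zero = a
a %′ suc n = a % suc n

-- Adjacency in MC(m^h); vertices are the naturals 0,…,m^h−1 (= ℤ_{m^h}).
-- x ~ y  iff  x ≠ y and y − x ≡ ±m^i (mod m^h) for some i ∈ {0,…,h−1}.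
-- (m ≥ 2 so m^h is nonzero; we use the suc-form of the modulus to avoid instances.)
Adj : (m h : ℕ) → ℕ → ℕ → Set
Adj m h x y =
  x < m ^ h × y < m ^ h × x ≢ y ×
  (∃ λ i → i < h × ((y ≡ (x + m ^ i) %′ (m ^ h)) ⊎ (x ≡ (y + m ^ i) %′ (m ^ h))))

data Walk (m h : ℕ) : ℕ → ℕ → ℕ → Set where
  here : ∀ {x} → x < m ^ h → Walk m h x x zero
  step : ∀ {x y z k} → Adj m h x y → Walk m h y z k → Walk m h x z (suc k)

IsDistance : (m h : ℕ) → (ℕ → ℕ → ℕ) → Set
IsDistance m h d =
  ∀ x y → x < m ^ h → y < m ^ h →
    Walk m h x y (d x y) × (∀ k → Walk m h x y k → d x y ≤ k)

totalDist : (N : ℕ) → (ℕ → ℕ → ℕ) → ℕ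
totalDist N d = sum (map (λ x → sum (map (λ y → d x y) (upTo N))) (upTo N))

-- a / b as a rational number (b = 0 gives 0; only used with b > 0).
frac : ℕ → ℕ → ℚ
frac a zero = 0ℚ
frac a (suc b) = (+ a) / suc b

avgDist : (N : ℕ) → (ℕ → ℕ → ℕ) → ℚ
avgDist N d = frac (totalDist N d) (N * (N ∸ 1))

-- The distance from x to y in MC(2^h) is the weight of y − x mod 2^h: the least number
-- of terms ±2^i (i < h) with that sum. An even n is halved by a representation, and an
-- odd n needs one ±1 first, so weight(h+1)(2m) = weight h m and
-- weight(h+1)(2m+1) = 1 + min (weight h m) (weight h (m+1)). As neighbouring weights
-- differ by at most one, the weight sums S h over a period satisfy
-- S(h+2) = S(h+1) + 2^(h+1) + 2 S h, whence 9 S h = 2^h (3h+1) ∓ 1 according to the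
-- parity of h, and μ = 2^h S h / (2^h (2^h − 1)).
module Submission where

open import Defs
import Data.Integer as ℤ
open import Data.Integer.Properties using (pos-*)
open import Data.List using (map; applyUpTo; upTo)
open import Data.Nat
open import Data.Nat.DivMod using (m≡m%n+[m/n]*n; [m+kn]%n≡m%n; m<n⇒m%n≡m; m%n<n)
open import Data.Nat.ListAction using (sum)
open import Data.Nat.Properties
open import Algebra.Properties.CommutativeSemigroup +-commutativeSemigroup
  using (xy∙z≈xz∙y; xy∙z≈x∙zy; interchange)
open import Data.Nat.Tactic.RingSolver using (solve-∀)
open import Data.Product using (∃; ∃₂; _×_; _,_; proj₁; proj₂)
open import Data.Rational.Properties using (fromℚᵘ-cong)
open import Data.Rational.Unnormalised using (mkℚᵘ; *≡*)
open import Data.Sum using (_⊎_; inj₁; inj₂)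
open import Level using (0ℓ)
open import Relation.Binary.Bundles using (Setoid)
open import Relation.Binary.PropositionalEquality
open import Relation.Binary.Structures using (IsEquivalence)
open import Relation.Nullary using (yes; no)

infix 4 _≡_mod_

_≡_mod_ : ℕ → ℕ → ℕ → Set
_≡_mod_ a b M = ∃₂ λ p q → a + p * M ≡ b + q * M

module _ {M : ℕ} where

  ≡-mod-refl : ∀ {a} → a ≡ a mod M
  ≡-mod-refl = 0 , 0 , refl

  ≡-mod-sym : ∀ {a b} → a ≡ b mod M → b ≡ a mod M
  ≡-mod-sym (p , q , e) = q , p , sym e

  ≡-mod-trans : ∀ {a b c} → a ≡ b mod M → b ≡ c mod M → a ≡ c mod M
  ≡-mod-trans {a} {b} {c} (p , q , a≡b) (r , s , b≡c) = p + r , s + q , (begin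
    a + (p + r) * M    ≡⟨ +-distrib-* a p r ⟩
    a + p * M + r * M  ≡⟨ cong (_+ r * M) a≡b ⟩
    b + q * M + r * M  ≡⟨ xy∙z≈xz∙y b (q * M) (r * M) ⟩
    b + r * M + q * M  ≡⟨ cong (_+ q * M) b≡c ⟩
    c + s * M + q * M  ≡⟨ +-distrib-* c s q ⟨
    c + (s + q) * M    ∎)
    where
    open ≡-Reasoning
    +-distrib-* : ∀ x u v → x + (u + v) * M ≡ x + u * M + v * M
    +-distrib-* x u v = trans (cong (x +_) (*-distribʳ-+ M u v)) (sym (+-assoc x _ _))

  ≡-mod-isEquivalence : IsEquivalence (λ a b → a ≡ b mod M)
  ≡-mod-isEquivalence = record { refl = ≡-mod-refl ; sym = ≡-mod-sym ; trans = ≡-mod-trans }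

  ≡⇒≡-mod : ∀ {a b} → a ≡ b → a ≡ b mod M
  ≡⇒≡-mod refl = ≡-mod-refl

  +-congʳ-mod : ∀ {a b} c → a ≡ b mod M → a + c ≡ b + c mod M
  +-congʳ-mod {a} {b} c (p , q , e) = p , q , (begin
    a + c + p * M  ≡⟨ xy∙z≈xz∙y a c (p * M) ⟩
    a + p * M + c  ≡⟨ cong (_+ c) e ⟩
    b + q * M + c  ≡⟨ xy∙z≈xz∙y b (q * M) c ⟩
    b + c + q * M  ∎)
    where open ≡-Reasoning

  +-congˡ-mod : ∀ {a b} c → a ≡ b mod M → c + a ≡ c + b mod M
  +-congˡ-mod {a} {b} c a≡b =
    subst₂ (λ u v → u ≡ v mod M) (+-comm a c) (+-comm b c) (+-congʳ-mod c a≡b)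

  +-cancelʳ-mod : ∀ {a b} c → a + c ≡ b + c mod M → a ≡ b mod M
  +-cancelʳ-mod {a} {b} c (p , q , e) = p , q , +-cancelʳ-≡ c _ _ (begin
    a + p * M + c  ≡⟨ xy∙z≈xz∙y a (p * M) c ⟩
    a + c + p * M  ≡⟨ e ⟩
    b + c + q * M  ≡⟨ xy∙z≈xz∙y b c (q * M) ⟩
    b + q * M + c  ∎)
    where open ≡-Reasoning

  +-self-mod : ∀ a → a + M ≡ a mod M
  +-self-mod a = 0 , 1 , trans (+-identityʳ (a + M)) (cong (a +_) (sym (+-identityʳ M)))

  +-∸-+-mod : ∀ a {c} → c ≤ M → a + (M ∸ c) + c ≡ a mod M
  +-∸-+-mod a c≤M =
    ≡-mod-trans (≡⇒≡-mod (trans (+-assoc a _ _) (cong (a +_) (m∸n+n≡m c≤M)))) (+-self-mod a)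

  module _ .{{_ : NonZero M}} where

    %-mod : ∀ a → a % M ≡ a mod M
    %-mod a = a / M , 0 , trans (sym (m≡m%n+[m/n]*n a M)) (sym (+-identityʳ a))

    ≡-mod⇒%≡ : ∀ {a b} → a ≡ b mod M → a % M ≡ b % M
    ≡-mod⇒%≡ {a} {b} (p , q , e) = begin
      a % M            ≡⟨ [m+kn]%n≡m%n a p M ⟨
      (a + p * M) % M  ≡⟨ cong (_% M) e ⟩
      (b + q * M) % M  ≡⟨ [m+kn]%n≡m%n b q M ⟩
      b % M            ∎
      where open ≡-Reasoning

    ≡-mod-<⇒≡ : ∀ {a b} → a < M → b < M → a ≡ b mod M → a ≡ b
    ≡-mod-<⇒≡ a<M b<M a≡b =
      trans (sym (m<n⇒m%n≡m a<M)) (trans (≡-mod⇒%≡ a≡b) (m<n⇒m%n≡m b<M))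

≡-mod-setoid : ℕ → Setoid 0ℓ 0ℓ
≡-mod-setoid M = record { isEquivalence = ≡-mod-isEquivalence {M} }

%′≡% : ∀ a M .{{_ : NonZero M}} → a %′ M ≡ a % M
%′≡% a (suc M) = refl

%′-mod : ∀ a M .{{_ : NonZero M}} → a %′ M ≡ a mod M
%′-mod a M = subst (λ r → r ≡ a mod M) (sym (%′≡% a M)) (%-mod a)

≡-mod⇒≡%′ : ∀ {a b M} .{{_ : NonZero M}} → b < M → a ≡ b mod M → b ≡ a %′ M
≡-mod⇒≡%′ {a} {b} {M} b<M a≡b =
  trans (sym (m<n⇒m%n≡m b<M)) (trans (sym (≡-mod⇒%≡ a≡b)) (sym (%′≡% a M)))

data EvenOdd : ℕ → Set where
  even : ∀ m → EvenOdd (m + m)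
  odd  : ∀ m → EvenOdd (suc (m + m))

evenOdd : ∀ n → EvenOdd n
evenOdd zero = even 0
evenOdd (suc n) with evenOdd n
... | even m = odd m
... | odd m  = subst EvenOdd (cong suc (+-suc m m)) (even (suc m))

double-+ : ∀ a c → a + a + 2 * c ≡ (a + c) + (a + c)
double-+ = solve-∀

double-+-* : ∀ a q M → a + a + q * (2 * M) ≡ (a + q * M) + (a + q * M)
double-+-* = solve-∀

double-mod : ∀ {a b M} → a ≡ b mod M → a + a ≡ b + b mod 2 * M
double-mod {a} {b} {M} (p , q , e) =
  p , q , trans (double-+-* a p M) (trans (cong₂ _+_ e e) (sym (double-+-* b q M)))

weightStep : (ℕ → ℕ) → ℕ → ℕ
weightStep w zero          = w 0
weightStep w (suc zero)    = suc (w 0 ⊓ w 1)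
weightStep w (suc (suc n)) = weightStep (λ k → w (suc k)) n

weight : ℕ → ℕ → ℕ
weight zero    n = 0
weight (suc h)   = weightStep (weight h)

weightStep-even : ∀ w m → weightStep w (m + m) ≡ w m
weightStep-even w zero = refl
weightStep-even w (suc m) rewrite +-suc m m = weightStep-even (λ k → w (suc k)) m

weightStep-odd : ∀ w m → weightStep w (suc (m + m)) ≡ suc (w m ⊓ w (suc m))
weightStep-odd w zero = refl
weightStep-odd w (suc m) rewrite +-suc m m = weightStep-odd (λ k → w (suc k)) m

weight-even : ∀ h m → weight (suc h) (m + m) ≡ weight h m
weight-even h = weightStep-even (weight h)

weight-even-suc : ∀ h m → weight (suc h) (suc (suc (m + m))) ≡ weight h (suc m)
weight-even-suc h = weightStep-even (λ k → weight h (suc k))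

weight-odd : ∀ h m → weight (suc h) (suc (m + m)) ≡ suc (weight h m ⊓ weight h (suc m))
weight-odd h = weightStep-odd (weight h)

weight-0 : ∀ h → weight h 0 ≡ 0
weight-0 zero    = refl
weight-0 (suc h) = weight-0 h

≤-suc-⊓ˡ : ∀ {a b} → a ≤ suc b → a ≤ suc (a ⊓ b)
≤-suc-⊓ˡ {a} a≤1+b = ⊓-glb (n≤1+n a) a≤1+b

≤-suc-⊓ʳ : ∀ {a b} → b ≤ suc a → b ≤ suc (a ⊓ b)
≤-suc-⊓ʳ {b = b} b≤1+a = ⊓-glb b≤1+a (n≤1+n b)

weight-suc-≤ : ∀ h n → weight h (suc n) ≤ suc (weight h n) × weight h n ≤ suc (weight h (suc n))
weight-suc-≤ zero n = z≤n , z≤n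
weight-suc-≤ (suc h) n with evenOdd n
... | even m rewrite weight-even h m | weight-odd h m =
  s≤s (m⊓n≤m _ _) , m≤n⇒m≤1+n (≤-suc-⊓ˡ (proj₂ (weight-suc-≤ h m)))
... | odd m rewrite weight-even-suc h m | weight-odd h m =
  m≤n⇒m≤1+n (≤-suc-⊓ʳ (proj₁ (weight-suc-≤ h m))) , s≤s (m⊓n≤n _ _)

weight-+2^-≤ : ∀ h i n →
  weight h (n + 2 ^ i) ≤ suc (weight h n) × weight h n ≤ suc (weight h (n + 2 ^ i))
weight-+2^-≤ zero i n = z≤n , z≤n
weight-+2^-≤ (suc h) zero n rewrite +-comm n 1 = weight-suc-≤ (suc h) n
weight-+2^-≤ (suc h) (suc i) n with evenOdd n
... | even m rewrite double-+ m (2 ^ i) | weight-even h (m + 2 ^ i) | weight-even h m =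
  weight-+2^-≤ h i m
... | odd m rewrite cong suc (double-+ m (2 ^ i)) | weight-odd h (m + 2 ^ i) | weight-odd h m =
  let m-up , m-down = weight-+2^-≤ h i m ; sm-up , sm-down = weight-+2^-≤ h i (suc m)
  in s≤s (⊓-mono-≤ m-up sm-up) , s≤s (⊓-mono-≤ m-down sm-down)

weight-periodic : ∀ h a q → weight h (a + q * 2 ^ h) ≡ weight h a
weight-periodic zero a q = refl
weight-periodic (suc h) a q with evenOdd a
... | even m rewrite double-+-* m q (2 ^ h) | weight-even h (m + q * 2 ^ h) | weight-even h m =
  weight-periodic h m q
... | odd m rewrite cong suc (double-+-* m q (2 ^ h)) | weight-odd h (m + q * 2 ^ h) | weight-odd h m =
  cong suc (cong₂ _⊓_ (weight-periodic h m q) (weight-periodic h (suc m) q))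

weight-cong-mod : ∀ h {a b} → a ≡ b mod 2 ^ h → weight h a ≡ weight h b
weight-cong-mod h {a} {b} (p , q , e) =
  trans (sym (weight-periodic h a p)) (trans (cong (weight h) e) (weight-periodic h b q))

weight≡0⇒≡0-mod : ∀ h n → weight h n ≡ 0 → n ≡ 0 mod 2 ^ h
weight≡0⇒≡0-mod zero n _ = 0 , n , trans (+-identityʳ n) (sym (*-identityʳ n))
weight≡0⇒≡0-mod (suc h) n w≡0 with evenOdd n
... | even m = double-mod (weight≡0⇒≡0-mod h m (trans (sym (weight-even h m)) w≡0))
... | odd m with () ← trans (sym (weight-odd h m)) w≡0

-- The second disjunct is the step n ↦ n − 2^i, phrased as a congruence to avoid truncation.
weight-descent : ∀ h n k → weight h n ≡ suc k →
  ∃ λ i → i < h × (weight h (n + 2 ^ i) ≡ k ⊎ ∃ λ m → m + 2 ^ i ≡ n mod 2 ^ h × weight h m ≡ k)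
weight-descent zero n k ()
weight-descent (suc h) n k w≡ with evenOdd n
... | even m with weight-descent h m k (trans (sym (weight-even h m)) w≡)
...   | i , i<h , inj₁ e = suc i , s≤s i<h ,
  inj₁ (trans (cong (weight (suc h)) (double-+ m (2 ^ i))) (trans (weight-even h _) e))
...   | i , i<h , inj₂ (m′ , m′+2^i≡m , e) = suc i , s≤s i<h ,
  inj₂ (m′ + m′ , ≡-mod-trans (≡⇒≡-mod (double-+ m′ (2 ^ i))) (double-mod m′+2^i≡m) ,
        trans (weight-even h m′) e)
weight-descent (suc h) n k w≡ | odd m
  with suc-injective (trans (sym (weight-odd h m)) w≡) | weight h m ≤? weight h (suc m)
... | ⊓≡k | yes m≤sm = 0 , z<s ,
  inj₂ (m + m , ≡⇒≡-mod (+-comm (m + m) 1) ,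
        trans (weight-even h m) (trans (sym (m≤n⇒m⊓n≡m m≤sm)) ⊓≡k))
... | ⊓≡k | no m≰sm = 0 , z<s ,
  inj₁ (trans (cong (weight (suc h)) (+-comm (suc (m + m)) 1))
        (trans (weight-even-suc h m) (trans (sym (m≥n⇒m⊓n≡n (<⇒≤ (≰⇒> m≰sm)))) ⊓≡k)))

-- gap M x y stands for y − x modulo M; adding M first keeps the subtraction untruncated.
gap : ℕ → ℕ → ℕ → ℕ
gap M x y = y + (M ∸ x)

gap-+ : ∀ {M x} y → x ≤ M → gap M x y + x ≡ y mod M
gap-+ {M} {x} y x≤M =
  ≡-mod-trans (≡⇒≡-mod (trans (+-assoc y _ x) (cong (y +_) (m∸n+n≡m x≤M)))) (+-self-mod y)

gap-shift : ∀ {M x x′ c} y → x ≤ M → x′ ≤ M → x + c ≡ x′ mod M → gap M x′ y + c ≡ gap M x y mod M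
gap-shift {M} {x} {x′} {c} y x≤M x′≤M x+c≡x′ = +-cancelʳ-mod x (begin
  gap M x′ y + c + x    ≡⟨ xy∙z≈x∙zy (gap M x′ y) c x ⟩
  gap M x′ y + (x + c)  ≈⟨ +-congˡ-mod (gap M x′ y) x+c≡x′ ⟩
  gap M x′ y + x′       ≈⟨ gap-+ y x′≤M ⟩
  y                     ≈⟨ gap-+ y x≤M ⟨
  gap M x y + x         ∎)
  where open import Relation.Binary.Reasoning.Setoid (≡-mod-setoid M)

distance : ℕ → ℕ → ℕ → ℕ
distance h x y = weight h (gap (2 ^ h) x y)

module _ (h : ℕ) where

  private
    M = 2 ^ h
    instance
      M≢0 : NonZero M
      M≢0 = m^n≢0 2 h

  distance-self : ∀ {x} → x ≤ M → distance h x x ≡ 0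
  distance-self {x} x≤M =
    trans (weight-cong-mod h (+-cancelʳ-mod x (gap-+ x x≤M))) (weight-0 h)

  distance≡0⇒≡ : ∀ {x y} → x < M → y < M → distance h x y ≡ 0 → x ≡ y
  distance≡0⇒≡ {x} {y} x<M y<M d≡0 = ≡-mod-<⇒≡ x<M y<M (≡-mod-sym (begin
    y              ≈⟨ gap-+ y (<⇒≤ x<M) ⟨
    gap M x y + x  ≈⟨ +-congʳ-mod x (weight≡0⇒≡0-mod h _ d≡0) ⟩
    x              ∎))
    where open import Relation.Binary.Reasoning.Setoid (≡-mod-setoid M)

  adj⇒≡-mod : ∀ {x x′} → Adj 2 h x x′ →
    ∃ λ i → i < h × (x + 2 ^ i ≡ x′ mod M ⊎ x′ + 2 ^ i ≡ x mod M)
  adj⇒≡-mod {x} {x′} (_ , _ , _ , i , i<h , inj₁ x′≡) =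
    i , i<h , inj₁ (subst (λ z → x + 2 ^ i ≡ z mod M) (sym x′≡) (≡-mod-sym (%′-mod _ M)))
  adj⇒≡-mod {x} {x′} (_ , _ , _ , i , i<h , inj₂ x≡) =
    i , i<h , inj₂ (subst (λ z → x′ + 2 ^ i ≡ z mod M) (sym x≡) (≡-mod-sym (%′-mod _ M)))

  distance-shift : ∀ {x x′ c} y → x < M → x′ < M → x + c ≡ x′ mod M →
    distance h x y ≡ weight h (gap M x′ y + c)
  distance-shift y x<M x′<M x+c≡x′ =
    weight-cong-mod h (≡-mod-sym (gap-shift y (<⇒≤ x<M) (<⇒≤ x′<M) x+c≡x′))

  distance-adj-≤ : ∀ {x x′} y → Adj 2 h x x′ → distance h x y ≤ suc (distance h x′ y)
  distance-adj-≤ {x} {x′} y adj@(x<M , x′<M , _) with adj⇒≡-mod adj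
  ... | i , _ , inj₁ x+2^i≡x′ = begin
    weight h (gap M x y)           ≡⟨ distance-shift y x<M x′<M x+2^i≡x′ ⟩
    weight h (gap M x′ y + 2 ^ i)  ≤⟨ proj₁ (weight-+2^-≤ h i _) ⟩
    suc (weight h (gap M x′ y))    ∎
    where open ≤-Reasoning
  ... | i , _ , inj₂ x′+2^i≡x = begin
    weight h (gap M x y)                ≤⟨ proj₂ (weight-+2^-≤ h i _) ⟩
    suc (weight h (gap M x y + 2 ^ i))  ≡⟨ cong suc (distance-shift y x′<M x<M x′+2^i≡x) ⟨
    suc (weight h (gap M x′ y))         ∎
    where open ≤-Reasoning

  distance-≤-walk : ∀ {x y k} → Walk 2 h x y k → distance h x y ≤ k
  distance-≤-walk (here x<M)   = ≤-reflexive (distance-self (<⇒≤ x<M))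
  distance-≤-walk (step adj w) = ≤-trans (distance-adj-≤ _ adj) (s≤s (distance-≤-walk w))

  step-towards : ∀ {x x′ y k i} → x < M → x′ < M → i < h →
    x + 2 ^ i ≡ x′ mod M ⊎ x′ + 2 ^ i ≡ x mod M →
    distance h x y ≡ suc k → distance h x′ y ≡ k → Walk 2 h x′ y k → Walk 2 h x y (suc k)
  step-towards {x} {x′} {i = i} x<M x′<M i<h x~x′ dx dx′ =
    step (x<M , x′<M , x≢x′ , i , i<h , adjacent x~x′)
    where
    x≢x′ : x ≢ x′
    x≢x′ refl = 1+n≢n (trans (sym dx) dx′)
    adjacent : x + 2 ^ i ≡ x′ mod M ⊎ x′ + 2 ^ i ≡ x mod M →
               x′ ≡ (x + 2 ^ i) %′ M ⊎ x ≡ (x′ + 2 ^ i) %′ M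
    adjacent (inj₁ x+2^i≡x′) = inj₁ (≡-mod⇒≡%′ x′<M x+2^i≡x′)
    adjacent (inj₂ x′+2^i≡x) = inj₂ (≡-mod⇒≡%′ x<M x′+2^i≡x)

  walk-distance : ∀ {y} → y < M → ∀ k {x} → x < M → distance h x y ≡ k → Walk 2 h x y k
  walk-distance {y} y<M zero {x} x<M d≡0 =
    subst (λ z → Walk 2 h z y 0) (sym (distance≡0⇒≡ x<M y<M d≡0)) (here y<M)
  walk-distance {y} y<M (suc k) {x} x<M d≡ with weight-descent h (gap M x y) k d≡
  ... | i , i<h , inj₁ up≡k =
    step-towards x<M x′<M i<h (inj₂ x′+2^i≡x) d≡ dx′ (walk-distance y<M k x′<M dx′)
    where
    x′ = (x + (M ∸ 2 ^ i)) % M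
    x′<M = m%n<n _ M
    x′+2^i≡x : x′ + 2 ^ i ≡ x mod M
    x′+2^i≡x = ≡-mod-trans (+-congʳ-mod (2 ^ i) (%-mod _))
                           (+-∸-+-mod x (^-monoʳ-≤ 2 (<⇒≤ i<h)))
    dx′ : distance h x′ y ≡ k
    dx′ = trans (distance-shift y x′<M x<M x′+2^i≡x) up≡k
  ... | i , i<h , inj₂ (m , m+2^i≡gap , m≡k) =
    step-towards x<M x′<M i<h (inj₁ x+2^i≡x′) d≡ dx′ (walk-distance y<M k x′<M dx′)
    where
    x′ = (x + 2 ^ i) % M
    x′<M = m%n<n _ M
    x+2^i≡x′ : x + 2 ^ i ≡ x′ mod M
    x+2^i≡x′ = ≡-mod-sym (%-mod _)
    dx′ : distance h x′ y ≡ k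
    dx′ = trans (weight-cong-mod h (+-cancelʳ-mod (2 ^ i)
            (≡-mod-trans (gap-shift y (<⇒≤ x<M) (<⇒≤ x′<M) x+2^i≡x′) (≡-mod-sym m+2^i≡gap))))
            m≡k

  distance-isDistance : IsDistance 2 h (distance h)
  distance-isDistance x y x<M y<M = walk-distance y<M _ x<M refl , λ _ → distance-≤-walk

sumBelow : ℕ → (ℕ → ℕ) → ℕ
sumBelow zero    f = 0
sumBelow (suc n) f = f 0 + sumBelow n (λ k → f (suc k))

sum-map-applyUpTo : ∀ {A : Set} n (f : A → ℕ) g → sum (map f (applyUpTo g n)) ≡ sumBelow n (λ k → f (g k))
sum-map-applyUpTo zero    f g = refl
sum-map-applyUpTo (suc n) f g = cong (f (g 0) +_) (sum-map-applyUpTo n f (λ k → g (suc k)))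

sumBelow-cong : ∀ n {f g} → (∀ k → f k ≡ g k) → sumBelow n f ≡ sumBelow n g
sumBelow-cong zero    f≗g = refl
sumBelow-cong (suc n) f≗g = cong₂ _+_ (f≗g 0) (sumBelow-cong n (λ k → f≗g (suc k)))

sumBelow-+ : ∀ n f g → sumBelow n (λ k → f k + g k) ≡ sumBelow n f + sumBelow n g
sumBelow-+ zero    f g = refl
sumBelow-+ (suc n) f g = trans
  (cong (f 0 + g 0 +_) (sumBelow-+ n (λ k → f (suc k)) (λ k → g (suc k))))
  (interchange (f 0) (g 0) _ _)

sumBelow-const : ∀ n c → sumBelow n (λ _ → c) ≡ n * c
sumBelow-const zero    c = refl
sumBelow-const (suc n) c = cong (c +_) (sumBelow-const n c)

sumBelow-suc : ∀ n f → sumBelow (suc n) f ≡ sumBelow n f + f n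
sumBelow-suc zero    f = +-comm (f 0) 0
sumBelow-suc (suc n) f =
  trans (cong (f 0 +_) (sumBelow-suc n (λ k → f (suc k)))) (sym (+-assoc (f 0) _ _))

sumBelow-rotate : ∀ n f → f n ≡ f 0 → sumBelow n (λ k → f (suc k)) ≡ sumBelow n f
sumBelow-rotate n f fn≡f0 = +-cancelʳ-≡ (f 0) _ _ (begin
  sumBelow n (λ k → f (suc k)) + f 0  ≡⟨ +-comm _ (f 0) ⟩
  sumBelow (suc n) f                  ≡⟨ sumBelow-suc n f ⟩
  sumBelow n f + f n                  ≡⟨ cong (sumBelow n f +_) fn≡f0 ⟩
  sumBelow n f + f 0                  ∎)
  where open ≡-Reasoning

sumBelow-shift : ∀ n f → (∀ k → f (k + n) ≡ f k) → ∀ c → sumBelow n (λ k → f (k + c)) ≡ sumBelow n f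
sumBelow-shift n f periodic zero = sumBelow-cong n (λ k → cong f (+-identityʳ k))
sumBelow-shift n f periodic (suc c) = begin
  sumBelow n (λ k → f (k + suc c))    ≡⟨ sumBelow-cong n (λ k → cong f (+-suc k c)) ⟩
  sumBelow n (λ k → f (suc (k + c)))  ≡⟨ sumBelow-rotate n (λ k → f (k + c)) (trans (cong f (+-comm n c)) (periodic c)) ⟩
  sumBelow n (λ k → f (k + c))        ≡⟨ sumBelow-shift n f periodic c ⟩
  sumBelow n f                        ∎
  where open ≡-Reasoning

sumBelow-pairs : ∀ n f → sumBelow (n + n) f ≡ sumBelow n (λ m → f (m + m) + f (suc (m + m)))
sumBelow-pairs zero    f = refl
sumBelow-pairs (suc n) f rewrite +-suc n n = begin
  f 0 + (f 1 + sumBelow (n + n) (λ k → f (2 + k)))                 ≡⟨ +-assoc (f 0) (f 1) _ ⟨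
  f 0 + f 1 + sumBelow (n + n) (λ k → f (2 + k))                   ≡⟨ cong (f 0 + f 1 +_) (sumBelow-pairs n (λ k → f (2 + k))) ⟩
  f 0 + f 1 + sumBelow n (λ m → f (2 + (m + m)) + f (3 + (m + m)))  ≡⟨ cong (f 0 + f 1 +_) (sumBelow-cong n shifted) ⟩
  f 0 + f 1 + sumBelow n (λ m → f (suc m + suc m) + f (suc (suc m + suc m))) ∎
  where
  open ≡-Reasoning
  shifted : ∀ m → f (2 + (m + m)) + f (3 + (m + m)) ≡ f (suc m + suc m) + f (suc (suc m + suc m))
  shifted m rewrite +-suc m m = refl

weightSum : ℕ → ℕ
weightSum h = sumBelow (2 ^ h) (weight h)

2^suc≡2^+2^ : ∀ h → 2 ^ suc h ≡ 2 ^ h + 2 ^ h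
2^suc≡2^+2^ h = cong (2 ^ h +_) (+-identityʳ (2 ^ h))

weightSum-suc : ∀ h →
  weightSum (suc h) ≡ weightSum h + 2 ^ h + sumBelow (2 ^ h) (λ m → weight h m ⊓ weight h (suc m))
weightSum-suc h = begin
  sumBelow (2 ^ suc h) (weight (suc h))                 ≡⟨ cong (λ n → sumBelow n (weight (suc h))) (2^suc≡2^+2^ h) ⟩
  sumBelow (2 ^ h + 2 ^ h) (weight (suc h))             ≡⟨ sumBelow-pairs (2 ^ h) (weight (suc h)) ⟩
  sumBelow (2 ^ h) (λ m → weight (suc h) (m + m) + weight (suc h) (suc (m + m)))
                                                        ≡⟨ sumBelow-cong (2 ^ h) pair ⟩
  sumBelow (2 ^ h) (λ m → weight h m + (1 + min m))     ≡⟨ sumBelow-+ (2 ^ h) (weight h) _ ⟩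
  weightSum h + sumBelow (2 ^ h) (λ m → 1 + min m)      ≡⟨ cong (weightSum h +_) (sumBelow-+ (2 ^ h) (λ _ → 1) min) ⟩
  weightSum h + (sumBelow (2 ^ h) (λ _ → 1) + Σmin)     ≡⟨ cong (λ t → weightSum h + (t + Σmin)) (trans (sumBelow-const (2 ^ h) 1) (*-identityʳ _)) ⟩
  weightSum h + (2 ^ h + Σmin)                          ≡⟨ +-assoc (weightSum h) _ _ ⟨
  weightSum h + 2 ^ h + Σmin                            ∎
  where
  open ≡-Reasoning
  min = λ m → weight h m ⊓ weight h (suc m)
  Σmin = sumBelow (2 ^ h) min
  pair : ∀ m → weight (suc h) (m + m) + weight (suc h) (suc (m + m)) ≡ weight h m + (1 + min m)
  pair m rewrite weight-even h m | weight-odd h m = refl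

weight-+2^ : ∀ h a → weight h (a + 2 ^ h) ≡ weight h a
weight-+2^ h a = weight-cong-mod h (+-self-mod a)

-- Since neighbouring weights differ by at most one, the two minima over 2a, 2a+1, 2a+2
-- are weight h a and weight h (a + 1).
sumBelow-weight-⊓ : ∀ h →
  sumBelow (2 ^ suc h) (λ m → weight (suc h) m ⊓ weight (suc h) (suc m)) ≡ weightSum h + weightSum h
sumBelow-weight-⊓ h = begin
  sumBelow (2 ^ suc h) min                                    ≡⟨ cong (λ n → sumBelow n min) (2^suc≡2^+2^ h) ⟩
  sumBelow (2 ^ h + 2 ^ h) min                                ≡⟨ sumBelow-pairs (2 ^ h) min ⟩
  sumBelow (2 ^ h) (λ a → min (a + a) + min (suc (a + a)))    ≡⟨ sumBelow-cong (2 ^ h) pair ⟩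
  sumBelow (2 ^ h) (λ a → weight h a + weight h (suc a))      ≡⟨ sumBelow-+ (2 ^ h) (weight h) _ ⟩
  weightSum h + sumBelow (2 ^ h) (λ a → weight h (suc a))     ≡⟨ cong (weightSum h +_) (sumBelow-rotate (2 ^ h) (weight h) (weight-+2^ h 0)) ⟩
  weightSum h + weightSum h                                   ∎
  where
  open ≡-Reasoning
  min = λ m → weight (suc h) m ⊓ weight (suc h) (suc m)
  pair : ∀ a → min (a + a) + min (suc (a + a)) ≡ weight h a + weight h (suc a)
  pair a rewrite weight-even h a | weight-odd h a | weight-even-suc h a =
    cong₂ _+_ (m≤n⇒m⊓n≡m (≤-suc-⊓ˡ (proj₂ (weight-suc-≤ h a))))
              (m≥n⇒m⊓n≡n (≤-suc-⊓ʳ (proj₁ (weight-suc-≤ h a))))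

weightSum-recurrence : ∀ h →
  weightSum (2 + h) ≡ weightSum (1 + h) + 2 ^ (1 + h) + (weightSum h + weightSum h)
weightSum-recurrence h =
  trans (weightSum-suc (suc h)) (cong (weightSum (suc h) + 2 ^ suc h +_) (sumBelow-weight-⊓ h))

weightSum-closed-form : ∀ k →
  9 * weightSum (k * 2) + 1 ≡ 2 ^ (k * 2) * (3 * (k * 2) + 1) ×
  9 * weightSum (1 + k * 2) ≡ 2 ^ (1 + k * 2) * (3 * (1 + k * 2) + 1) + 1
weightSum-closed-form zero    = refl , refl
weightSum-closed-form (suc k) = even-step , odd-step
  where
  open ≡-Reasoning
  n = k * 2
  p = 2 ^ n
  S : ℕ → ℕ
  S i = weightSum (i + n)
  even-ih = proj₁ (weightSum-closed-form k)
  odd-ih  = proj₂ (weightSum-closed-form k)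

  expand-even : ∀ s₀ s₁ p → 9 * (s₁ + 2 * p + (s₀ + s₀)) + 1 + 1 ≡ 9 * s₁ + 18 * p + 2 * (9 * s₀ + 1)
  expand-even = solve-∀
  collect-even : ∀ p n → 2 * p * (3 * (1 + n) + 1) + 1 + 18 * p + 2 * (p * (3 * n + 1))
                       ≡ 2 * (2 * p) * (3 * (2 + n) + 1) + 1
  collect-even = solve-∀
  expand-odd : ∀ s₁ s₂ p → 9 * (s₂ + 2 * (2 * p) + (s₁ + s₁)) + 1 ≡ 9 * s₂ + 1 + 36 * p + 2 * (9 * s₁)
  expand-odd = solve-∀
  collect-odd : ∀ p n → 2 * (2 * p) * (3 * (2 + n) + 1) + 36 * p + 2 * (2 * p * (3 * (1 + n) + 1) + 1)
                      ≡ 2 * (2 * (2 * p)) * (3 * (3 + n) + 1) + 1 + 1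
  collect-odd = solve-∀

  even-step : 9 * S 2 + 1 ≡ 2 ^ (2 + n) * (3 * (2 + n) + 1)
  even-step = +-cancelʳ-≡ 1 _ _ (begin
    9 * S 2 + 1 + 1                                  ≡⟨ cong (λ s → 9 * s + 1 + 1) (weightSum-recurrence n) ⟩
    9 * (S 1 + 2 * p + (S 0 + S 0)) + 1 + 1          ≡⟨ expand-even (S 0) (S 1) p ⟩
    9 * S 1 + 18 * p + 2 * (9 * S 0 + 1)             ≡⟨ cong₂ (λ a b → a + 18 * p + 2 * b) odd-ih even-ih ⟩
    2 * p * (3 * (1 + n) + 1) + 1 + 18 * p + 2 * (p * (3 * n + 1)) ≡⟨ collect-even p n ⟩
    2 * (2 * p) * (3 * (2 + n) + 1) + 1              ∎)

  odd-step : 9 * S 3 ≡ 2 ^ (3 + n) * (3 * (3 + n) + 1) + 1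
  odd-step = +-cancelʳ-≡ 1 _ _ (begin
    9 * S 3 + 1                                      ≡⟨ cong (λ s → 9 * s + 1) (weightSum-recurrence (1 + n)) ⟩
    9 * (S 2 + 2 * (2 * p) + (S 1 + S 1)) + 1        ≡⟨ expand-odd (S 1) (S 2) p ⟩
    9 * S 2 + 1 + 36 * p + 2 * (9 * S 1)             ≡⟨ cong₂ (λ a b → a + 36 * p + 2 * b) even-step odd-ih ⟩
    2 * (2 * p) * (3 * (2 + n) + 1) + 36 * p + 2 * (2 * p * (3 * (1 + n) + 1) + 1) ≡⟨ collect-odd p n ⟩
    2 * (2 * (2 * p)) * (3 * (3 + n) + 1) + 1 + 1    ∎)

weightSum-even : ∀ h → h % 2 ≡ 0 → 9 * weightSum h ≡ 2 ^ h * (3 * h + 1) ∸ 1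
weightSum-even h h%2≡0 = subst (λ n → 9 * weightSum n ≡ 2 ^ n * (3 * n + 1) ∸ 1) (sym h≡k*2)
  (trans (sym (m+n∸n≡m _ 1)) (cong (_∸ 1) (proj₁ (weightSum-closed-form (h / 2)))))
  where
  h≡k*2 : h ≡ h / 2 * 2
  h≡k*2 = trans (m≡m%n+[m/n]*n h 2) (cong (_+ h / 2 * 2) h%2≡0)

weightSum-odd : ∀ h → h % 2 ≡ 1 → 9 * weightSum h ≡ 2 ^ h * (3 * h + 1) + 1
weightSum-odd h h%2≡1 = subst (λ n → 9 * weightSum n ≡ 2 ^ n * (3 * n + 1) + 1) (sym h≡1+k*2)
  (proj₂ (weightSum-closed-form (h / 2)))
  where
  h≡1+k*2 : h ≡ 1 + h / 2 * 2
  h≡1+k*2 = trans (m≡m%n+[m/n]*n h 2) (cong (_+ h / 2 * 2) h%2≡1)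

totalDist-distance : ∀ h → totalDist (2 ^ h) (distance h) ≡ 2 ^ h * weightSum h
totalDist-distance h = begin
  totalDist M (distance h)                             ≡⟨ sum-map-applyUpTo M _ (λ x → x) ⟩
  sumBelow M (λ x → sum (map (distance h x) (upTo M))) ≡⟨ sumBelow-cong M row ⟩
  sumBelow M (λ _ → weightSum h)                       ≡⟨ sumBelow-const M (weightSum h) ⟩
  M * weightSum h                                      ∎
  where
  open ≡-Reasoning
  M = 2 ^ h
  row : ∀ x → sum (map (distance h x) (upTo M)) ≡ weightSum h
  row x = trans (sum-map-applyUpTo M (distance h x) (λ y → y))
                (sumBelow-shift M (weight h) (weight-+2^ h) (M ∸ x))

frac-cong : ∀ a b c d → a * suc d ≡ c * suc b → frac a (suc b) ≡ frac c (suc d)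
frac-cong a b c d ad≡cb = fromℚᵘ-cong {mkℚᵘ (ℤ.+ a) b} {mkℚᵘ (ℤ.+ c) d}
  (*≡* (trans (sym (pos-* a (suc d))) (trans (cong ℤ.+_ ad≡cb) (pos-* c (suc b)))))

frac-*-cancelˡ : ∀ a {b} c → 0 < b → 0 < c → frac (c * a) (c * b) ≡ frac a b
frac-*-cancelˡ a {suc b} (suc c) _ _ = frac-cong (suc c * a) _ a b (cross a b c)
  where
  cross : ∀ a b c → suc c * a * suc b ≡ a * (suc c * suc b)
  cross = solve-∀

avgDist-distance : ∀ {h} → 0 < h → avgDist (2 ^ h) (distance h) ≡ frac (9 * weightSum h) (9 * (2 ^ h ∸ 1))
avgDist-distance {h} 0<h = begin
  frac (totalDist M (distance h)) (M * (M ∸ 1))  ≡⟨ cong (λ t → frac t (M * (M ∸ 1))) (totalDist-distance h) ⟩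
  frac (M * weightSum h) (M * (M ∸ 1))           ≡⟨ frac-*-cancelˡ (weightSum h) M 0<M-1 (m^n>0 2 h) ⟩
  frac (weightSum h) (M ∸ 1)                     ≡⟨ frac-*-cancelˡ (weightSum h) 9 0<M-1 z<s ⟨
  frac (9 * weightSum h) (9 * (M ∸ 1))           ∎
  where
  open ≡-Reasoning
  M = 2 ^ h
  0<M-1 : 0 < M ∸ 1
  0<M-1 = m<n⇒0<n∸m (^-monoʳ-< 2 (s≤s (s≤s z≤n)) 0<h)

theorem3p25 : ∀ (h : ℕ) → 0 < h →
    ∃ λ (d : ℕ → ℕ → ℕ) → IsDistance 2 h d ×
      ((h % 2 ≡ 0 → avgDist (2 ^ h) d ≡ frac (2 ^ h * (3 * h + 1) ∸ 1) (9 * (2 ^ h ∸ 1))) ×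
       (h % 2 ≡ 1 → avgDist (2 ^ h) d ≡ frac (2 ^ h * (3 * h + 1) + 1) (9 * (2 ^ h ∸ 1))))
theorem3p25 h 0<h =
  distance h , distance-isDistance h ,
  (λ h-even → average (weightSum-even h h-even)) , (λ h-odd → average (weightSum-odd h h-odd))
  where
  average : ∀ {s} → 9 * weightSum h ≡ s → avgDist (2 ^ h) (distance h) ≡ frac s (9 * (2 ^ h ∸ 1))
  average 9S≡s = trans (avgDist-distance 0<h) (cong (λ t → frac t (9 * (2 ^ h ∸ 1))) 9S≡s)
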